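{- Work in $\mathrm{ZF}$. Let $G = (M, E)$ be an extensional digraph, and let $\mathbb{V}_\omega(G) = (M_\omega, E_\omega)$ be as defined in the context. Then: (1) $\mathbb{V}_{\omega}(G) \models \mathrm{Z} - \mathrm{Infinity}$; (2) $\mathbb{V}_{\omega}(G)$ has a true power set operator: for every $X \in M_{\omega}$ and every $Y \subseteq \{x \in M_{\omega} : x \mathrel{E_{\omega}} X\}$ there is $Y' \in M_{\omega}$ with $Y = \{x \in M_{\omega} : x \mathrel{E_{\omega}} Y'\}$.
   Context: An extensional digraph is a set $M$ with a binary relation $E$ on $M$ such that distinct elements of $M$ have distinct sets of $E$-predecessors. For an extensional digraph $G = (M,E)$, its deficiency is $$D(G) = \{X \subseteq M : \neg \exists y \in M\, \forall z \in M\, (z \in X \leftrightarrow z \mathrel{E} y)\},$$ the set of subsets of $M$ that are not the set of $E$-predecessors of any element. Define digraphs $\mathbb{V}_n(G) = (M_n, E_n)$ recursively: - $M_0 = \{0\} \times M$ and $E_0 = \{((0,x),(0,y)) : x \mathrel{E} y\}$; - $M_{n+1} = M_n \cup (\{n+1\} \times D(\mathbb{V}_n(G)))$ and $E_{n+1} = E_n \cup \{(z,(n+1,X)) : z \in X,\ X \in D(\mathbb{V}_n(G))\}$; - $M_\omega = \bigcup_{n<\omega} M_n$ and $E_\omega = \bigcup_{n<\omega} E_n$. $\mathbb{V}_\omega(G) = (M_\omega, E_\omega)$ is regarded as a structure for the language $\{\in\}$, with $E_\omega$ interpreting $\in$. $\mathrm{Z} - \mathrm{Infinity}$ is the theory consisting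 of Extensionality, Pairing, Union, the Comprehension schema, and Power Set; Foundation is not included. -}

module Defs where

open import Level using (0ℓ)
open import Data.Nat.Base using (ℕ; zero; suc)
open import Data.Fin.Base using (Fin; zero; suc)
open import Data.Bool.Base using (Bool; true)
open import Data.Product using (Σ; _×_; _,_)
open import Data.Sum using (_⊎_; inj₁; inj₂)
open import Data.Empty using (⊥)
open import Relation.Nullary using (¬_)
open import Relation.Binary.PropositionalEquality using (_≡_)
open import Function.Bundles using (_⇔_)

-- Digraphs (a carrier with a binary relation E; x E y read "x ∈ y")

record Digraph : Set₁ where
  constructor digraph
  field
    Carrier : Set
    _E_     : Carrier → Carrier → Set

open Digraph public

IsExtensional : Digraph → Set
IsExtensional G =
  ∀ x y → (∀ z → _E_ G z x ⇔ _E_ G z y) → x ≡ y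

Realizes : (G : Digraph) → (Carrier G → Bool) → Carrier G → Set
Realizes G X y = ∀ z → (X z ≡ true) ⇔ _E_ G z y

Deficient : (G : Digraph) → (Carrier G → Bool) → Set
Deficient G X = ¬ Σ (Carrier G) (Realizes G X)

D : Digraph → Set
D G = Σ (Carrier G → Bool) (Deficient G)

-- The stages V_n(G).  M_{n+1} = M_n ⊎ D(V_n(G)) (the right summand is the
-- tagged copy {n+1} × D(V_n(G))); E_{n+1} = E_n ∪ {(z,(n+1,X)) : z ∈ X}.

stepRel : (H : Digraph) → Carrier H ⊎ D H → Carrier H ⊎ D H → Set
stepRel H (inj₁ a) (inj₁ b)       = _E_ H a b
stepRel H (inj₁ a) (inj₂ (X , _)) = X a ≡ true
stepRel H (inj₂ _) _              = ⊥

Step : Digraph → Digraph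
Step H = digraph (Carrier H ⊎ D H) (stepRel H)

V : Digraph → ℕ → Digraph
V G zero    = G
V G (suc n) = Step (V G n)

-- V_ω(G).  M_ω is the disjoint union of the "new" parts:
-- {0} × M  and  {n+1} × D(V_n(G)).

New : Digraph → ℕ → Set
New G zero    = Carrier G
New G (suc n) = D (V G n)

Mω : Digraph → Set
Mω G = Σ ℕ (New G)

data _≼_ : ℕ → ℕ → Set where
  ≼-refl : ∀ {i} → i ≼ i
  ≼-step : ∀ {i j} → i ≼ j → i ≼ suc j

newIn : (G : Digraph) → (n : ℕ) → New G n → Carrier (V G n)
newIn G zero    a = a
newIn G (suc n) a = inj₂ a

embed : (G : Digraph) → ∀ {i j} → i ≼ j → New G i → Carrier (V G j)
embed G {i} ≼-refl     a = newIn G i a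
embed G     (≼-step p) a = inj₁ (embed G p a)

Eω : (G : Digraph) → Mω G → Mω G → Set
Eω G (zero  , a) (zero  , b)      = _E_ G a b
Eω G (suc i , _) (zero  , _)      = ⊥
Eω G (i     , a) (suc j , (X , _)) = Σ (i ≼ j) λ p → X (embed G p a) ≡ true

Vω : Digraph → Digraph
Vω G = digraph (Mω G) (Eω G)

infixr 6 _∧̇_
infixr 5 _∨̇_
infixr 4 _⇒̇_

data Formula : ℕ → Set where
  _∈̇_ : ∀ {n} → Fin n → Fin n → Formula n
  _≐_  : ∀ {n} → Fin n → Fin n → Formula n
  ⊥̇    : ∀ {n} → Formula n
  _∧̇_ : ∀ {n} → Formula n → Formula n → Formula n
  _∨̇_ : ∀ {n} → Formula n → Formula n → Formula n
  _⇒̇_ : ∀ {n} → Formula n → Formula n → Formula n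
  ∀̇    : ∀ {n} → Formula (suc n) → Formula n
  ∃̇    : ∀ {n} → Formula (suc n) → Formula n

_∷ₑ_ : ∀ {A : Set} {n} → A → (Fin n → A) → Fin (suc n) → A
(a ∷ₑ ρ) zero    = a
(a ∷ₑ ρ) (suc i) = ρ i

Sat : (H : Digraph) → ∀ {n} → Formula n → (Fin n → Carrier H) → Set
Sat H (i ∈̇ j) ρ = _E_ H (ρ i) (ρ j)
Sat H (i ≐ j)  ρ = ρ i ≡ ρ j
Sat H ⊥̇        ρ = ⊥
Sat H (φ ∧̇ ψ) ρ = Sat H φ ρ × Sat H ψ ρ
Sat H (φ ∨̇ ψ) ρ = Sat H φ ρ ⊎ Sat H ψ ρ
Sat H (φ ⇒̇ ψ) ρ = Sat H φ ρ → Sat H ψ ρ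
Sat H (∀̇ φ)    ρ = ∀ a → Sat H φ (a ∷ₑ ρ)
Sat H (∃̇ φ)    ρ = Σ (Carrier H) λ a → Sat H φ (a ∷ₑ ρ)

record ZminusInfinity (H : Digraph) : Set where
  field
    extensionality : ∀ x y → (∀ z → _E_ H z x ⇔ _E_ H z y) → x ≡ y
    pairing        : ∀ x y → Σ (Carrier H) λ z →
                       ∀ w → _E_ H w z ⇔ (w ≡ x ⊎ w ≡ y)
    union          : ∀ x → Σ (Carrier H) λ y →
                       ∀ w → _E_ H w y ⇔ Σ (Carrier H) (λ v → _E_ H v x × _E_ H w v)
    comprehension  : ∀ n (φ : Formula (suc n)) (ρ : Fin n → Carrier H) (z : Carrier H) →
                       Σ (Carrier H) λ y →
                       ∀ x → _E_ H x y ⇔ (_E_ H x z × Sat H φ (x ∷ₑ ρ))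
    powerSet       : ∀ x → Σ (Carrier H) λ y →
                       ∀ z → _E_ H z y ⇔ (∀ w → _E_ H w z → _E_ H w x)

TruePowerSet : Digraph → Set₁
TruePowerSet H =
  ∀ (X : Carrier H) (Y : Carrier H → Set) →
  (∀ x → Y x → _E_ H x X) →
  Σ (Carrier H) λ Y′ → ∀ x → Y x ⇔ _E_ H x Y′

-- Classical ZF metatheory: excluded middle (for all types).
ExcludedMiddle : Set₁
ExcludedMiddle = ∀ (P : Set) → P ⊎ ¬ P

-- Every element of V_ω(G) has a finite level (the stage where it was added),
-- and its predecessors have no larger level. The heart of the proof: every
-- class S of elements of level ≤ n is the predecessor set of an element of
-- level ≤ n + 1, because S, read as a subset of M_n, is either realized in
-- V_n(G) already or deficient, and then it was added at stage n + 1. Pairing,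
-- union, comprehension and the true power set operator only ask for such
-- bounded classes. So does power set: by extensionality every z ⊆ x is the
-- code of its own predecessor class, which is bounded by the level of x, so z
-- has level ≤ level x + 1. Extensionality survives each stage because the
-- elements added are exactly the subsets not realized before.
module Submission where

open import Defs
open import Level using (0ℓ)
open import Axiom.Extensionality.Propositional using (Extensionality)
open import Data.Bool.Base using (Bool; true; false)
open import Data.Bool.Properties using (⇔→≡)
open import Data.Empty using (⊥-elim)
open import Data.Nat.Base using (ℕ; zero; suc; _≤_; _⊔_; z≤n; s≤s)
open import Data.Nat.Properties
  using (≤-refl; ≤-trans; ≤-pred; m≤n⇒m≤1+n; 1+n≰n; m≤m⊔n; m≤n⊔m)
open import Data.Product using (Σ; _×_; _,_; proj₁)
open import Data.Sum using (inj₁; inj₂; [_,_]′)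
open import Function.Base using (_∘_)
open import Function.Bundles using (_⇔_; mk⇔; Equivalence)
import Function.Properties.Equivalence as ⇔
open import Function.Construct.Identity using (⇔-id)
open import Relation.Nullary using (¬_)
open import Relation.Binary.PropositionalEquality
  using (_≡_; refl; sym; cong; subst; module ≡-Reasoning)

open Equivalence using (to; from)

≼⇒≤ : ∀ {i j} → i ≼ j → i ≤ j
≼⇒≤ ≼-refl     = ≤-refl
≼⇒≤ (≼-step p) = m≤n⇒m≤1+n (≼⇒≤ p)

≼-suc : ∀ {i j} → i ≼ j → suc i ≼ suc j
≼-suc ≼-refl     = ≼-refl
≼-suc (≼-step p) = ≼-step (≼-suc p)

0≼n : ∀ {n} → zero ≼ n
0≼n {zero}  = ≼-refl
0≼n {suc n} = ≼-step 0≼n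

≤⇒≼ : ∀ {i j} → i ≤ j → i ≼ j
≤⇒≼ z≤n     = 0≼n
≤⇒≼ (s≤s p) = ≼-suc (≤⇒≼ p)

≼-irrelevant : ∀ {i j} (p q : i ≼ j) → p ≡ q
≼-irrelevant ≼-refl     ≼-refl     = refl
≼-irrelevant ≼-refl     (≼-step q) = ⊥-elim (1+n≰n (≼⇒≤ q))
≼-irrelevant (≼-step p) ≼-refl     = ⊥-elim (1+n≰n (≼⇒≤ p))
≼-irrelevant (≼-step p) (≼-step q) = cong ≼-step (≼-irrelevant p q)

module Stages (G : Digraph) where

  level : Mω G → ℕ
  level = proj₁

  toMω : ∀ n → Carrier (V G n) → Mω G
  toMω zero    c        = zero , c
  toMω (suc n) (inj₁ c) = toMω n c
  toMω (suc n) (inj₂ d) = suc n , d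

  toMω-embed : ∀ {i n} (p : i ≼ n) a → toMω n (embed G p a) ≡ (i , a)
  toMω-embed {zero}  ≼-refl     a = refl
  toMω-embed {suc i} ≼-refl     a = refl
  toMω-embed         (≼-step p) a = toMω-embed p a

  embed-elim : ∀ n (P : Carrier (V G n) → Set) →
               (∀ {i} (p : i ≼ n) a → P (embed G p a)) → ∀ c → P c
  embed-elim zero    P h c        = h ≼-refl c
  embed-elim (suc n) P h (inj₁ c) = embed-elim n (P ∘ inj₁) (λ p → h (≼-step p)) c
  embed-elim (suc n) P h (inj₂ d) = h ≼-refl d

  Eω-level : ∀ z w → Eω G z w → level z ≤ level w
  Eω-level (zero  , a) (zero  , b) e       = z≤n
  Eω-level (zero  , a) (suc j , Y) e       = z≤n
  Eω-level (suc i , a) (suc j , Y) (p , _) = m≤n⇒m≤1+n (≼⇒≤ p)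

  -- Eω computes only once the level of its first argument is known.
  Eω-new : ∀ {i} a n (Y : Carrier (V G n) → Bool) dY →
           Eω G (i , a) (suc n , (Y , dY)) ⇔ Σ (i ≼ n) (λ r → Y (embed G r a) ≡ true)
  Eω-new {zero}  a n Y dY = ⇔-id _
  Eω-new {suc i} a n Y dY = ⇔-id _

  Eω-new-minimal : ∀ {n j} (q : j ≼ suc n) a b → ¬ Eω G (suc n , a) (j , b)
  Eω-new-minimal {j = suc j} q a b (r , _) =
    1+n≰n (≤-trans (≼⇒≤ r) (≤-pred (≼⇒≤ q)))

  E-embed⇔Eω : ∀ n {i j} (p : i ≼ n) (q : j ≼ n) a b →
               _E_ (V G n) (embed G p a) (embed G q b) ⇔ Eω G (i , a) (j , b)
  E-embed⇔Eω zero    ≼-refl     ≼-refl     a b = ⇔-id _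
  E-embed⇔Eω (suc n) (≼-step p) (≼-step q) a b = E-embed⇔Eω n p q a b
  E-embed⇔Eω (suc n) ≼-refl     q          a b = mk⇔ ⊥-elim (⊥-elim ∘ Eω-new-minimal q a b)
  E-embed⇔Eω (suc n) (≼-step p) ≼-refl     a (Y , dY) = ⇔.trans
    (mk⇔ (p ,_) λ { (r , y) → subst (λ r → Y (embed G r a) ≡ true) (≼-irrelevant r p) y })
    (⇔.sym (Eω-new a n Y dY))

module _ (fe : Extensionality 0ℓ 0ℓ) where

  D-≡ : ∀ H {X Y : Carrier H → Bool} (dX : Deficient H X) (dY : Deficient H Y) →
        X ≡ Y → _≡_ {A = D H} (X , dX) (Y , dY)
  D-≡ H dX dY refl = cong (_ ,_) (fe λ r → ⊥-elim (dX r))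

  Step-extensional : ∀ H → IsExtensional H → IsExtensional (Step H)
  Step-extensional H ext (inj₁ a)        (inj₁ b)        h = cong inj₁ (ext a b (h ∘ inj₁))
  Step-extensional H ext (inj₁ a)        (inj₂ (Y , dY)) h = ⊥-elim (dY (a , ⇔.sym ∘ h ∘ inj₁))
  Step-extensional H ext (inj₂ (X , dX)) (inj₁ b)        h = ⊥-elim (dX (b , h ∘ inj₁))
  Step-extensional H ext (inj₂ (X , dX)) (inj₂ (Y , dY)) h =
    cong inj₂ (D-≡ H dX dY (fe λ z → ⇔→≡ (h (inj₁ z))))

  V-extensional : ∀ G → IsExtensional G → ∀ n → IsExtensional (V G n)
  V-extensional G ext zero    = ext
  V-extensional G ext (suc n) = Step-extensional (V G n) (V-extensional G ext n)

  Vω-extensional : ∀ G → IsExtensional G → IsExtensional (Vω G)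
  Vω-extensional G ext (i , a) (j , b) h = begin
    (i , a)                 ≡⟨ sym (toMω-embed p a) ⟩
    toMω n (embed G p a)    ≡⟨ cong (toMω n) same-at-stage ⟩
    toMω n (embed G q b)    ≡⟨ toMω-embed q b ⟩
    (j , b)                 ∎
    where
      open Stages G
      open ≡-Reasoning
      n : ℕ
      n = i ⊔ j
      p : i ≼ n
      p = ≤⇒≼ (m≤m⊔n i j)
      q : j ≼ n
      q = ≤⇒≼ (m≤n⊔m i j)
      same-at-stage : embed G p a ≡ embed G q b
      same-at-stage = V-extensional G ext n _ _ (embed-elim n _ λ {k} r c →
        ⇔.trans (E-embed⇔Eω n r p c a) (⇔.trans (h (k , c)) (⇔.sym (E-embed⇔Eω n r q c b))))

module Coding (lem : ExcludedMiddle) (G : Digraph) where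
  open Stages G

  χ : Set → Bool
  χ P with lem P
  ... | inj₁ _ = true
  ... | inj₂ _ = false

  χ-true : ∀ P → (χ P ≡ true) ⇔ P
  χ-true P with lem P
  ... | inj₁ x  = mk⇔ (λ _ → x) (λ _ → refl)
  ... | inj₂ ¬x = mk⇔ (λ ()) (⊥-elim ∘ ¬x)

  Bounded : ℕ → (Mω G → Set) → Set
  Bounded n S = ∀ z → S z → level z ≤ n

  Codes : Mω G → (Mω G → Set) → Set
  Codes w S = ∀ z → Eω G z w ⇔ S z

  CodedBelow : ℕ → (Mω G → Set) → Set
  CodedBelow n S = Σ (Mω G) λ w → level w ≤ n × Codes w S

  bounded-class-coded : ∀ n S → Bounded n S → CodedBelow (suc n) S
  bounded-class-coded n S bound =
    [ (λ (y , realizes) → embed-elim n (λ y → Realizes (V G n) X y → CodedBelow (suc n) S)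
                            coded-by-old y realizes)
    , coded-by-new ]′ (lem (Σ (Carrier (V G n)) (Realizes (V G n) X)))
    where
      X : Carrier (V G n) → Bool
      X c = χ (S (toMω n c))

      X-embed : ∀ {k} (r : k ≼ n) b → (X (embed G r b) ≡ true) ⇔ S (k , b)
      X-embed r b rewrite toMω-embed r b = χ-true _

      coded-by-new : (deficient : Deficient (V G n) X) → CodedBelow (suc n) S
      coded-by-new deficient = (suc n , (X , deficient)) , ≤-refl , λ (k , b) →
        ⇔.trans (Eω-new b n X deficient)
          (mk⇔ (λ (r , x) → to (X-embed r b) x)
               (λ s → let r = ≤⇒≼ (bound _ s) in r , from (X-embed r b) s))

      coded-by-old : ∀ {i} (p : i ≼ n) a → Realizes (V G n) X (embed G p a) → CodedBelow (suc n) S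
      coded-by-old {i} p a realizes = (i , a) , m≤n⇒m≤1+n (≼⇒≤ p) , λ (k , b) →
        mk⇔ (λ e → let r = ≤⇒≼ (≤-trans (Eω-level _ _ e) (≼⇒≤ p)) in
                    to (X-embed r b) (from (realizes _) (from (E-embed⇔Eω n r p b a) e)))
            (λ s → let r = ≤⇒≼ (bound _ s) in
                    to (E-embed⇔Eω n r p b a) (to (realizes _) (from (X-embed r b) s)))

  coded : ∀ n S → Bounded n S → Σ (Mω G) λ w → Codes w S
  coded n S bound = let (w , _ , codes) = bounded-class-coded n S bound in w , codes

module _ (fe : Extensionality 0ℓ 0ℓ) (lem : ExcludedMiddle)
         (G : Digraph) (ext : IsExtensional G) where
  open Stages G
  open Coding lem G

  subset-level : ∀ x z → (∀ w → Eω G w z → Eω G w x) → level z ≤ suc (level x)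
  subset-level x z z⊆x =
    let (w , w-level , codes) = bounded-class-coded (level x) (λ w → Eω G w z)
                                  (λ w w∈z → Eω-level w x (z⊆x w w∈z))
    in subst (λ u → level u ≤ suc (level x))
             (sym (Vω-extensional fe G ext z w (⇔.sym ∘ codes))) w-level

  Vω-Z-Inf : ZminusInfinity (Vω G)
  Vω-Z-Inf = record
    { extensionality = Vω-extensional fe G ext
    ; pairing        = λ x y → coded (level x ⊔ level y) _
        λ { _ (inj₁ refl) → m≤m⊔n _ _ ; _ (inj₂ refl) → m≤n⊔m _ _ }
    ; union          = λ x → coded (level x) _
        λ w (v , v∈x , w∈v) → ≤-trans (Eω-level w v w∈v) (Eω-level v x v∈x)
    ; comprehension  = λ _ _ _ z → coded (level z) _ λ x (x∈z , _) → Eω-level x z x∈z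
    ; powerSet       = λ x → coded (suc (level x)) _ (subset-level x)
    }

  Vω-truePowerSet : TruePowerSet (Vω G)
  Vω-truePowerSet X Y Y⊆X =
    let (w , codes) = coded (level X) Y λ x y → Eω-level x X (Y⊆X x y)
    in w , ⇔.sym ∘ codes

proposition2 : Extensionality 0ℓ 0ℓ → ExcludedMiddle →
    (G : Digraph) → IsExtensional G →
    ZminusInfinity (Vω G) × TruePowerSet (Vω G)
proposition2 fe lem G ext = Vω-Z-Inf fe lem G ext , Vω-truePowerSet fe lem G ext
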